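{- Let $\ell$ be a non-negative integer and fix a level-degree sequence of a rooted tree. Among all rooted trees with this level-degree sequence, the level-greedy tree maximizes the number of vertices $z$ with $\operatorname{ecc}_T(z)\leq \ell$.
   Context: For a vertex $v$ of a tree $T$, $\operatorname{ecc}_T(v)=\max_{u\in V(T)} d_T(u,v)$ (distance in the underlying unrooted tree). In a rooted tree, the height of a vertex is its distance to the root. The level-degree sequence of a rooted tree is the list of multisets $L_0,L_1,\ldots$ where $L_i$ is the multiset of degrees of the vertices at height $i$ (so $L_0$ contains the degree of the root). The down-degree of the root is its degree; the down-degree of any other vertex is its degree minus one. Given a level-degree sequence, the level-greedy rooted tree is built as follows: for each $i$, place $|L_i|$ vertices on level $i$ and assign to them, from left to right, the degrees in $L_i$ in non-increasing order; then, for each level $i$ in turn, going from left to right through the vertices of level $i$, join each vertex of down-degree $d$ to the first $d$ so far unconnected vertices of level $i+1$. -}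

module Defs where

open import Data.Nat using (ℕ; zero; suc; pred; _+_; _*_; _∸_; _⊔_; _≤?_)
open import Data.Nat.Properties using (≤-decTotalOrder)
open import Data.List using (List; []; _∷_; _++_; map; length; take; drop; reverse; filter; foldr)
open import Data.List.Sort.MergeSort.Base ≤-decTotalOrder using (sort)
open import Relation.Nullary using (yes; no)
open import Data.Nat using (_≟_)

-- The root is the top node; the order of children is irrelevant for the
-- quantities below (level-degree sequence, eccentricities).
data Tree : Set where
  node : List Tree → Tree

zipLevels : List (List ℕ) → List (List ℕ) → List (List ℕ)
zipLevels [] ys = ys
zipLevels (x ∷ xs) [] = x ∷ xs
zipLevels (x ∷ xs) (y ∷ ys) = (x ++ y) ∷ zipLevels xs ys

mutual
  downLevels : Tree → List (List ℕ)
  downLevels (node ts) = (length ts ∷ []) ∷ forestLevels ts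

  forestLevels : List Tree → List (List ℕ)
  forestLevels [] = []
  forestLevels (t ∷ ts) = zipLevels (downLevels t) (forestLevels ts)

-- level-degree sequence L₀, L₁, … (degrees in the underlying unrooted tree):
-- root degree = number of children, other vertices have one extra (parent) edge
degLevels : Tree → List (List ℕ)
degLevels t with downLevels t
... | [] = []
... | l₀ ∷ rest = l₀ ∷ map (map suc) rest

-- two level-degree sequences are equal: same number of levels, and equal
-- multisets on each level (Pointwise _↭_ is used in the statement)

sortDesc : List ℕ → List ℕ
sortDesc xs = reverse (sort xs)

toDown : List (List ℕ) → List (List ℕ)
toDown [] = []
toDown (l₀ ∷ rest) = l₀ ∷ map (map pred) rest

assign : List ℕ → List Tree → List Tree
assign [] fs = []
assign (d ∷ ds) fs = node (take d fs) ∷ assign ds (drop d fs)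

buildLevels : List (List ℕ) → List Tree
buildLevels [] = []
buildLevels (ds ∷ rest) = assign ds (buildLevels rest)

headTree : List Tree → Tree
headTree [] = node []
headTree (t ∷ _) = t

greedy : List (List ℕ) → Tree
greedy L = headTree (buildLevels (map sortDesc (toDown L)))

-- a vertex is addressed by its path from the root (list of child indices)
mutual
  positions : Tree → List (List ℕ)
  positions (node ts) = [] ∷ forestPos 0 ts

  forestPos : ℕ → List Tree → List (List ℕ)
  forestPos i [] = []
  forestPos i (t ∷ ts) = map (i ∷_) (positions t) ++ forestPos (suc i) ts

-- depth of the lowest common ancestor
commonPrefixLen : List ℕ → List ℕ → ℕ
commonPrefixLen [] q = 0
commonPrefixLen (x ∷ p) [] = 0
commonPrefixLen (x ∷ p) (y ∷ q) with x ≟ y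
... | yes _ = suc (commonPrefixLen p q)
... | no _ = 0

-- distance in the underlying unrooted tree:
-- d(u,v) = h(u) + h(v) - 2 h(lca(u,v))
dist : List ℕ → List ℕ → ℕ
dist p q = (length p + length q) ∸ (2 * commonPrefixLen p q)

ecc : Tree → List ℕ → ℕ
ecc t v = foldr _⊔_ 0 (map (dist v) (positions t))

countEccLe : ℕ → Tree → ℕ
countEccLe ℓ t = length (filter (λ z → ecc t z ≤? ℓ) (positions t))

module Submission where

-- Call such vertices central.  They have height at most ℓ, so it suffices
-- to compare the numbers centralAt k of central vertices at each height k.
-- After counting lemmas, levels of forests and distances, the core lemma
-- (Comparison.compare) compares centralAt k w and centralAt k g whenever w
-- is dominated by g (levels no wider, and subtrees dominated by the leftmost
-- subtree of g) and the deep levels of w are at least as wide: either all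
-- height-k vertices of g are central, or a deep vertex forces the central
-- vertices of w into one branch, and induction passes to that branch and the
-- leftmost branch of g.  Next, the greedy tree is shown to realise the given
-- levels and, as its levels are non-increasing and prefix sums of such lists
-- are maximal, to dominate every tree with the same levels.

open import Defs
open import Data.Nat using (ℕ; zero; suc; pred; _+_; _*_; _∸_; _⊔_; _⊓_; _≤_; _≥_; _<_; _≤?_; _<?_; _≟_; z≤n; s≤s; s≤s⁻¹)
open import Data.Nat.Properties
open import Algebra.Properties.CommutativeSemigroup +-commutativeSemigroup using (x∙yz≈y∙xz)
open import Data.Product using (_×_; _,_; proj₁; proj₂; Σ; ∃-syntax)
open import Data.Sum using (inj₁; inj₂)
open import Data.Empty using (⊥-elim)
open import Data.Unit using (⊤; tt)
open import Data.List using (List; []; _∷_; _++_; map; length; take; drop; reverse; filter; foldr)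
open import Data.Nat.ListAction using (sum)
open import Data.Nat.ListAction.Properties using (sum-↭)
open import Data.List.Properties using (length-++; ++-identityʳ; ++-assoc; map-++; length-map; length-take; take++drop≡id; take-take; length-drop; take-all; unfold-reverse)
open import Data.List.Relation.Unary.All using (All; []; _∷_; tabulate; lookup; all?)
open import Data.List.Relation.Unary.All.Properties using (¬All⇒Any¬)
open import Data.List.Relation.Unary.AllPairs using (AllPairs; []; _∷_)
import Data.List.Relation.Unary.AllPairs.Properties as AllPairs
open import Data.List.Relation.Unary.Linked.Properties using (Linked⇒AllPairs)
open import Data.List.Relation.Unary.Any using (here; there)
open import Data.List.Membership.Propositional using (_∈_; find)
open import Data.List.Membership.Propositional.Properties using (∈-map⁺; ∈-map⁻; ∈-++⁺ˡ; ∈-++⁺ʳ; ∈-++⁻; ∈-∃++)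
open import Data.List.Relation.Binary.Pointwise using (Pointwise; []; _∷_)
open import Data.List.Relation.Binary.Permutation.Propositional using (_↭_; ↭-sym; ↭-trans; ↭-refl; module PermutationReasoning)
open import Data.List.Relation.Binary.Permutation.Propositional.Properties using (↭-reverse; ∈-resp-↭; shift; drop-∷; ↭-length; ↭-empty-inv; ++⁺ˡ; ++⁺ʳ; ++-comm; map⁺)
open import Data.List.Sort.MergeSort.Base ≤-decTotalOrder using (sort)
open import Data.List.Sort.MergeSort.Properties ≤-decTotalOrder using (sort-↭; sort-↗)
open import Relation.Binary.PropositionalEquality
open import Relation.Binary.Definitions using (tri<; tri≈; tri>)
open import Relation.Nullary using (Dec; yes; no; ¬_)
open import Relation.Nullary.Decidable using (_×-dec_; ¬?)

count : {A : Set} {P : A → Set} → (∀ x → Dec (P x)) → List A → ℕ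
count P? [] = 0
count P? (x ∷ xs) with P? x
... | yes _ = suc (count P? xs)
... | no _ = count P? xs

module _ {A : Set} {P : A → Set} (P? : ∀ x → Dec (P x)) where

  length-filter≡count : ∀ xs → length (filter P? xs) ≡ count P? xs
  length-filter≡count [] = refl
  length-filter≡count (x ∷ xs) with P? x
  ... | yes _ = cong suc (length-filter≡count xs)
  ... | no _ = length-filter≡count xs

  count-none : ∀ xs → (∀ x → x ∈ xs → ¬ P x) → count P? xs ≡ 0
  count-none [] none = refl
  count-none (x ∷ xs) none with P? x
  ... | yes p = ⊥-elim (none x (here refl) p)
  ... | no _ = count-none xs (λ y y∈xs → none y (there y∈xs))

  count-witness : ∀ xs → 1 ≤ count P? xs → ∃[ x ] (x ∈ xs × P x)
  count-witness (x ∷ xs) pos with P? x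
  ... | yes p = x , here refl , p
  ... | no _ with count-witness xs pos
  ... | y , y∈xs , p = y , there y∈xs , p

  count-member : ∀ xs x → x ∈ xs → P x → 1 ≤ count P? xs
  count-member (y ∷ xs) x x∈ p with P? y
  ... | yes _ = s≤s z≤n
  count-member (y ∷ xs) x (here refl) p | no ¬p = ⊥-elim (¬p p)
  count-member (y ∷ xs) x (there x∈xs) p | no _ = count-member xs x x∈xs p

  count-++ : ∀ xs ys → count P? (xs ++ ys) ≡ count P? xs + count P? ys
  count-++ [] ys = refl
  count-++ (x ∷ xs) ys with P? x
  ... | yes _ = cong suc (count-++ xs ys)
  ... | no _ = count-++ xs ys

  count-skip : ∀ x xs → ¬ P x → count P? (x ∷ xs) ≡ count P? xs
  count-skip x xs ¬p with P? x
  ... | yes p = ⊥-elim (¬p p)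
  ... | no _ = refl

  count-∷-≥ : ∀ x xs → count P? xs ≤ count P? (x ∷ xs)
  count-∷-≥ x xs with P? x
  ... | yes _ = n≤1+n _
  ... | no _ = ≤-refl

  count-split : {Q : A → Set} (Q? : ∀ x → Dec (Q x)) → ∀ xs →
    count P? xs ≡ count (λ x → P? x ×-dec Q? x) xs + count (λ x → P? x ×-dec ¬? (Q? x)) xs
  count-split Q? [] = refl
  count-split Q? (x ∷ xs) with P? x | Q? x
  ... | yes _ | yes _ = cong suc (count-split Q? xs)
  ... | yes _ | no _ = trans (cong suc (count-split Q? xs)) (sym (+-suc _ _))
  ... | no _ | _ = count-split Q? xs

count-map : {A B : Set} {P : B → Set} (P? : ∀ x → Dec (P x)) (f : A → B) (xs : List A) →
  count P? (map f xs) ≡ count (λ x → P? (f x)) xs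
count-map P? f [] = refl
count-map P? f (x ∷ xs) with P? (f x)
... | yes _ = cong suc (count-map P? f xs)
... | no _ = count-map P? f xs

count-mono : {A : Set} {P Q : A → Set} (P? : ∀ x → Dec (P x)) (Q? : ∀ x → Dec (Q x)) (xs : List A) →
  (∀ x → x ∈ xs → P x → Q x) → count P? xs ≤ count Q? xs
count-mono P? Q? [] P⇒Q = z≤n
count-mono P? Q? (x ∷ xs) P⇒Q with P? x | Q? x
... | yes p | yes q = s≤s (count-mono P? Q? xs (λ y y∈xs → P⇒Q y (there y∈xs)))
... | yes p | no ¬q = ⊥-elim (¬q (P⇒Q x (here refl) p))
... | no _ | yes _ = m≤n⇒m≤1+n (count-mono P? Q? xs (λ y y∈xs → P⇒Q y (there y∈xs)))
... | no _ | no _ = count-mono P? Q? xs (λ y y∈xs → P⇒Q y (there y∈xs))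

count-cong : {A : Set} {P Q : A → Set} (P? : ∀ x → Dec (P x)) (Q? : ∀ x → Dec (Q x)) (xs : List A) →
  (∀ x → P x → Q x) → (∀ x → Q x → P x) → count P? xs ≡ count Q? xs
count-cong P? Q? xs P⇒Q Q⇒P =
  ≤-antisym (count-mono P? Q? xs (λ x _ → P⇒Q x)) (count-mono Q? P? xs (λ x _ → Q⇒P x))

atHeight : {R : List ℕ → Set} → (∀ z → Dec (R z)) → ℕ → List (List ℕ) → ℕ
atHeight R? k = count (λ z → (length z ≟ k) ×-dec R? z)

below : {R : List ℕ → Set} → (∀ z → Dec (R z)) → ℕ → List (List ℕ) → ℕ
below R? K = count (λ z → (length z <? K) ×-dec R? z)

below-suc : {R : List ℕ → Set} (R? : ∀ z → Dec (R z)) → ∀ K xs →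
  below R? (suc K) xs ≡ below R? K xs + atHeight R? K xs
below-suc R? K xs = trans (count-split _ (λ z → length z <? K) xs) (cong₂ _+_
  (count-cong _ _ xs (λ _ ((_ , r) , h<K) → h<K , r) (λ _ (h<K , r) → (m≤n⇒m≤1+n h<K , r) , h<K))
  (count-cong _ _ xs (λ _ ((h<1+K , r) , h≮K) → ≤∧≮⇒≡ (s≤s⁻¹ h<1+K) h≮K , r)
                     (λ { _ (refl , r) → (≤-refl , r) , n≮n _ })))

below-mono : {P Q : List ℕ → Set} (P? : ∀ z → Dec (P z)) (Q? : ∀ z → Dec (Q z)) → ∀ K xs ys →
  (∀ k → k < K → atHeight P? k xs ≤ atHeight Q? k ys) → below P? K xs ≤ below Q? K ys
below-mono P? Q? zero xs ys _ = ≤-trans (≤-reflexive (count-none _ xs (λ _ _ (h<0 , _) → n≮0 h<0))) z≤n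
below-mono P? Q? (suc K) xs ys cmp = begin
  below P? (suc K) xs                   ≡⟨ below-suc P? K xs ⟩
  below P? K xs + atHeight P? K xs      ≤⟨ +-mono-≤ (below-mono P? Q? K xs ys (λ k k<K → cmp k (m≤n⇒m≤1+n k<K)))
                                                    (cmp K ≤-refl) ⟩
  below Q? K ys + atHeight Q? K ys      ≡⟨ below-suc Q? K ys ⟨
  below Q? (suc K) ys                   ∎
  where open ≤-Reasoning

subtrees : Tree → List Tree
subtrees (node ts) = ts

down : Tree → ℕ
down (node ts) = length ts

children : List Tree → List Tree
children [] = []
children (t ∷ ts) = subtrees t ++ children ts

downAt : List Tree → ℕ → List ℕ
downAt F zero = map down F
downAt F (suc r) = downAt (children F) r

levels : Tree → ℕ → List ℕ
levels t = downAt (t ∷ [])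

levels-suc : ∀ ts r → levels (node ts) (suc r) ≡ downAt ts r
levels-suc ts r = cong (λ F → downAt F r) (++-identityʳ ts)

children-++ : ∀ xs ys → children (xs ++ ys) ≡ children xs ++ children ys
children-++ [] ys = refl
children-++ (x ∷ xs) ys =
  trans (cong (subtrees x ++_) (children-++ xs ys)) (sym (++-assoc (subtrees x) (children xs) (children ys)))

downAt-++ : ∀ xs ys r → downAt (xs ++ ys) r ≡ downAt xs r ++ downAt ys r
downAt-++ xs ys zero = map-++ down xs ys
downAt-++ xs ys (suc r) = trans (cong (λ F → downAt F r) (children-++ xs ys)) (downAt-++ (children xs) (children ys) r)

downAt-[] : ∀ r → downAt [] r ≡ []
downAt-[] zero = refl
downAt-[] (suc r) = downAt-[] r

length-children : ∀ X → length (children X) ≡ sum (map down X)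
length-children [] = refl
length-children (node ts ∷ X) = trans (length-++ ts) (cong (length ts +_) (length-children X))

sum-downAt : ∀ X r → sum (downAt X r) ≡ length (downAt X (suc r))
sum-downAt X zero = sym (trans (length-map down (children X)) (length-children X))
sum-downAt X (suc r) = sum-downAt (children X) r

-- the p-th tree of a forest (a leaf when out of range)
branch : List Tree → ℕ → Tree
branch [] _ = node []
branch (t ∷ ts) zero = t
branch (t ∷ ts) (suc p) = branch ts p

levels-branch : ∀ ts p r → p < length ts → length (levels (branch ts p) r) ≤ length (downAt ts r)
levels-branch (t ∷ ts) p r p<len rewrite downAt-++ (t ∷ []) ts r | length-++ (levels t r) {downAt ts r}
  with p | p<len
... | zero | _ = m≤m+n _ _
... | suc p | s≤s p<len = ≤-trans (levels-branch ts p r p<len) (m≤n+m _ _)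

-- the r-th entry of a list of levels ([] beyond its end)
entry : List (List ℕ) → ℕ → List ℕ
entry [] r = []
entry (l ∷ L) zero = l
entry (l ∷ L) (suc r) = entry L r

entry-zipLevels : ∀ a b r → entry (zipLevels a b) r ≡ entry a r ++ entry b r
entry-zipLevels [] b r = refl
entry-zipLevels (x ∷ a) [] r = sym (++-identityʳ (entry (x ∷ a) r))
entry-zipLevels (x ∷ a) (y ∷ b) zero = refl
entry-zipLevels (x ∷ a) (y ∷ b) (suc r) = entry-zipLevels a b r

mutual
  entry-downLevels : ∀ t r → entry (downLevels t) r ≡ levels t r
  entry-downLevels (node ts) zero = refl
  entry-downLevels (node ts) (suc r) = trans (entry-forestLevels ts r) (sym (levels-suc ts r))

  entry-forestLevels : ∀ ts r → entry (forestLevels ts) r ≡ downAt ts r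
  entry-forestLevels [] r = sym (downAt-[] r)
  entry-forestLevels (t ∷ ts) r = begin
    entry (zipLevels (downLevels t) (forestLevels ts)) r  ≡⟨ entry-zipLevels (downLevels t) (forestLevels ts) r ⟩
    entry (downLevels t) r ++ entry (forestLevels ts) r   ≡⟨ cong₂ _++_ (entry-downLevels t r) (entry-forestLevels ts r) ⟩
    levels t r ++ downAt ts r                             ≡⟨ downAt-++ (t ∷ []) ts r ⟨
    downAt (t ∷ ts) r                                     ∎
    where open ≡-Reasoning

entry-map-suc : ∀ A r → entry (map (map suc) A) r ≡ map suc (entry A r)
entry-map-suc [] r = refl
entry-map-suc (a ∷ A) zero = refl
entry-map-suc (a ∷ A) (suc r) = entry-map-suc A r

entry-pointwise : ∀ {A B} → Pointwise _↭_ A B → ∀ r → entry A r ↭ entry B r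
entry-pointwise [] r = ↭-refl
entry-pointwise (p ∷ ps) zero = p
entry-pointwise (p ∷ ps) (suc r) = entry-pointwise ps r

Nonempty : List ℕ → Set
Nonempty l = ¬ (l ≡ [])

pointwise-entry : ∀ A B → All Nonempty A → All Nonempty B → (∀ r → entry A r ↭ entry B r) → Pointwise _↭_ A B
pointwise-entry [] [] _ _ same = []
pointwise-entry (a ∷ A) [] (a≢[] ∷ _) _ same = ⊥-elim (a≢[] (↭-empty-inv (same 0)))
pointwise-entry [] (b ∷ B) _ (b≢[] ∷ _) same = ⊥-elim (b≢[] (↭-empty-inv (↭-sym (same 0))))
pointwise-entry (a ∷ A) (b ∷ B) (_ ∷ neA) (_ ∷ neB) same = same 0 ∷ pointwise-entry A B neA neB (λ r → same (suc r))

zipLevels-nonempty : ∀ a b → All Nonempty a → All Nonempty b → All Nonempty (zipLevels a b)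
zipLevels-nonempty [] b _ neb = neb
zipLevels-nonempty (x ∷ a) [] nea _ = nea
zipLevels-nonempty (x ∷ a) (y ∷ b) (_ ∷ nea) (y≢[] ∷ neb) = ++-nonempty x ∷ zipLevels-nonempty a b nea neb
  where
  ++-nonempty : ∀ x → Nonempty (x ++ y)
  ++-nonempty [] = y≢[]
  ++-nonempty (_ ∷ _) ()

mutual
  downLevels-nonempty : ∀ t → All Nonempty (downLevels t)
  downLevels-nonempty (node ts) = (λ ()) ∷ forestLevels-nonempty ts

  forestLevels-nonempty : ∀ ts → All Nonempty (forestLevels ts)
  forestLevels-nonempty [] = []
  forestLevels-nonempty (t ∷ ts) =
    zipLevels-nonempty (downLevels t) (forestLevels ts) (downLevels-nonempty t) (forestLevels-nonempty ts)

map-pred-suc : ∀ (a : List ℕ) → map pred (map suc a) ≡ a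
map-pred-suc [] = refl
map-pred-suc (x ∷ a) = cong (x ∷_) (map-pred-suc a)

↭-map-suc⁻ : ∀ {a b : List ℕ} → map suc a ↭ map suc b → a ↭ b
↭-map-suc⁻ {a} {b} p = subst₂ _↭_ (map-pred-suc a) (map-pred-suc b) (map⁺ pred p)

sameDegLevels⇒sameLevels : ∀ T T₀ → Pointwise _↭_ (degLevels T) (degLevels T₀) → ∀ r → levels T r ↭ levels T₀ r
sameDegLevels⇒sameLevels (node xs) (node ts) (root ∷ _) zero = root
sameDegLevels⇒sameLevels (node xs) (node ts) (_ ∷ rest) (suc r) = begin
  levels (node xs) (suc r)  ≡⟨ trans (levels-suc xs r) (sym (entry-forestLevels xs r)) ⟩
  entry (forestLevels xs) r ↭⟨ ↭-map-suc⁻ (subst₂ _↭_ (entry-map-suc (forestLevels xs) r) (entry-map-suc (forestLevels ts) r)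
                                  (entry-pointwise rest r)) ⟩
  entry (forestLevels ts) r ≡⟨ trans (entry-forestLevels ts r) (sym (levels-suc ts r)) ⟩
  levels (node ts) (suc r)  ∎
  where open PermutationReasoning

sameLevels⇒sameDegLevels : ∀ T T₀ → (∀ r → levels T r ↭ levels T₀ r) → Pointwise _↭_ (degLevels T) (degLevels T₀)
sameLevels⇒sameDegLevels (node xs) (node ts) same = same 0 ∷ map-suc-pointwise
  (pointwise-entry (forestLevels xs) (forestLevels ts) (forestLevels-nonempty xs) (forestLevels-nonempty ts)
    λ r → subst₂ _↭_ (trans (levels-suc xs r) (sym (entry-forestLevels xs r)))
                     (trans (levels-suc ts r) (sym (entry-forestLevels ts r))) (same (suc r)))
  where
  map-suc-pointwise : ∀ {A B} → Pointwise _↭_ A B → Pointwise _↭_ (map (map suc) A) (map (map suc) B)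
  map-suc-pointwise [] = []
  map-suc-pointwise (p ∷ ps) = map⁺ suc p ∷ map-suc-pointwise ps

forestPos-view : ∀ i ts z → z ∈ forestPos i ts →
  ∃[ p ] ∃[ u ] (z ≡ (i + p) ∷ u × p < length ts × u ∈ positions (branch ts p))
forestPos-view i (t ∷ ts) z z∈ with ∈-++⁻ (map (i ∷_) (positions t)) z∈
... | inj₁ z∈t with ∈-map⁻ (i ∷_) z∈t
...   | u , u∈t , refl = 0 , u , cong (_∷ u) (sym (+-identityʳ i)) , s≤s z≤n , u∈t
forestPos-view i (t ∷ ts) z z∈ | inj₂ z∈ts with forestPos-view (suc i) ts z z∈ts
...   | p , u , refl , p<len , u∈ = suc p , u , cong (_∷ u) (sym (+-suc i p)) , s≤s p<len , u∈

forestPos-branch : ∀ i ts p u → p < length ts → u ∈ positions (branch ts p) → (i + p) ∷ u ∈ forestPos i ts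
forestPos-branch i (t ∷ ts) zero u _ u∈ rewrite +-identityʳ i = ∈-++⁺ˡ (∈-map⁺ (i ∷_) u∈)
forestPos-branch i (t ∷ ts) (suc p) u (s≤s p<len) u∈ rewrite +-suc i p =
  ∈-++⁺ʳ (map (i ∷_) (positions t)) (forestPos-branch (suc i) ts p u p<len u∈)

position-branch : ∀ ts p u → p < length ts → u ∈ positions (branch ts p) → p ∷ u ∈ positions (node ts)
position-branch ts p u p<len u∈ = there (forestPos-branch 0 ts p u p<len u∈)

position-branch⁻ : ∀ ts p u → p ∷ u ∈ positions (node ts) → p < length ts × u ∈ positions (branch ts p)
position-branch⁻ ts p u (there z∈) with forestPos-view 0 ts (p ∷ u) z∈
... | _ , _ , refl , p<len , u∈ = p<len , u∈

root-position : ∀ x → [] ∈ positions x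
root-position (node ts) = here refl

width : ℕ → Tree → ℕ
width r x = count (λ z → length z ≟ r) (positions x)

mutual
  width≡length-levels : ∀ t r → width r t ≡ length (levels t r)
  width≡length-levels (node ts) zero = cong suc (count-none _ (forestPos 0 ts) nonroot)
    where
    nonroot : ∀ z → z ∈ forestPos 0 ts → ¬ (length z ≡ 0)
    nonroot z z∈ with forestPos-view 0 ts z z∈
    ... | _ , _ , refl , _ = λ ()
  width≡length-levels (node ts) (suc r) = trans (forestWidth 0 ts r) (cong length (sym (levels-suc ts r)))

  forestWidth : ∀ i ts r → count (λ z → length z ≟ suc r) (forestPos i ts) ≡ length (downAt ts r)
  forestWidth i [] r = sym (cong length (downAt-[] r))
  forestWidth i (t ∷ ts) r = begin
    count atSuc (map (i ∷_) (positions t) ++ forestPos (suc i) ts)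
      ≡⟨ count-++ atSuc (map (i ∷_) (positions t)) (forestPos (suc i) ts) ⟩
    count atSuc (map (i ∷_) (positions t)) + count atSuc (forestPos (suc i) ts)
      ≡⟨ cong₂ _+_ (trans (count-map atSuc (i ∷_) (positions t))
                     (count-cong _ _ (positions t) (λ _ → suc-injective) (λ _ → cong suc)))
                   (forestWidth (suc i) ts r) ⟩
    width r t + length (downAt ts r)
      ≡⟨ cong (_+ length (downAt ts r)) (width≡length-levels t r) ⟩
    length (levels t r) + length (downAt ts r)
      ≡⟨ length-++ (levels t r) ⟨
    length (levels t r ++ downAt ts r)
      ≡⟨ cong length (downAt-++ (t ∷ []) ts r) ⟨
    length (downAt (t ∷ ts) r) ∎
    where
    open ≡-Reasoning
    atSuc = λ (z : List ℕ) → length z ≟ suc r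

width-branch : ∀ ts p r → p < length ts → width r (branch ts p) ≤ width (suc r) (node ts)
width-branch ts p r p<len rewrite width≡length-levels (branch ts p) r | width≡length-levels (node ts) (suc r)
  | levels-suc ts r = levels-branch ts p r p<len

width-two-branches : ∀ g₀ gs p r → p < length gs → width r g₀ + width r (branch gs p) ≤ width (suc r) (node (g₀ ∷ gs))
width-two-branches g₀ gs p r p<len
  rewrite width≡length-levels (node (g₀ ∷ gs)) (suc r) | levels-suc (g₀ ∷ gs) r | downAt-++ (g₀ ∷ []) gs r
  | length-++ (levels g₀ r) {downAt gs r} | width≡length-levels g₀ r | width≡length-levels (branch gs p) r =
  +-monoʳ-≤ _ (levels-branch gs p r p<len)

sameLevels⇒sameWidth : ∀ x y → (∀ r → levels x r ↭ levels y r) → ∀ r → width r x ≡ width r y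
sameLevels⇒sameWidth x y same r =
  trans (width≡length-levels x r) (trans (↭-length (same r)) (sym (width≡length-levels y r)))

width-one : ∀ t → width 1 t ≡ down t
width-one (node ts) = trans (width≡length-levels (node ts) 1) (trans (length-map down (ts ++ [])) (cong length (++-identityʳ ts)))

dist-root : ∀ z → dist z [] ≡ length z
dist-root [] = refl
dist-root (i ∷ a) = +-identityʳ (suc (length a))

dist-≤ : ∀ a b → dist a b ≤ length a + length b
dist-≤ a b = m∸n≤m (length a + length b) (2 * commonPrefixLen a b)

dist-same-branch : ∀ i a b → dist (i ∷ a) (i ∷ b) ≡ dist a b
dist-same-branch i a b with i ≟ i
... | no i≢i = ⊥-elim (i≢i refl)
... | yes _ rewrite +-suc (length a) (length b)
                  | +-suc (commonPrefixLen a b) (commonPrefixLen a b + 0) = refl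

dist-other-branch : ∀ i j a b → ¬ i ≡ j → dist (i ∷ a) (j ∷ b) ≡ length (i ∷ a) + length (j ∷ b)
dist-other-branch i j a b i≢j with i ≟ j
... | yes i≡j = ⊥-elim (i≢j i≡j)
... | no _ = refl

max≤⇒All≤ : {A : Set} (ℓ : ℕ) (f : A → ℕ) (xs : List A) → foldr _⊔_ 0 (map f xs) ≤ ℓ → All (λ u → f u ≤ ℓ) xs
max≤⇒All≤ ℓ f [] _ = []
max≤⇒All≤ ℓ f (x ∷ xs) bound =
  ≤-trans (m≤m⊔n (f x) _) bound ∷ max≤⇒All≤ ℓ f xs (≤-trans (m≤n⊔m (f x) _) bound)

All≤⇒max≤ : {A : Set} (ℓ : ℕ) (f : A → ℕ) (xs : List A) → All (λ u → f u ≤ ℓ) xs → foldr _⊔_ 0 (map f xs) ≤ ℓ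
All≤⇒max≤ ℓ f [] [] = z≤n
All≤⇒max≤ ℓ f (x ∷ xs) (fx≤ ∷ rest) = ⊔-lub fx≤ (All≤⇒max≤ ℓ f xs rest)

InBranch : ℕ → List ℕ → Set
InBranch p z = ∃[ u ] z ≡ p ∷ u

forestPos-head : ∀ i ts z → z ∈ forestPos i ts → ∃[ j ] ∃[ u ] (z ≡ j ∷ u × i ≤ j)
forestPos-head i ts z z∈ with forestPos-view i ts z z∈
... | p , u , z≡ , _ = i + p , u , z≡ , m≤m+n i p

module _ {P : List ℕ → Set} (P? : ∀ z → Dec (P z)) where

  count-before-branch : ∀ i ts p0 → p0 < i → (∀ z → z ∈ forestPos i ts → P z → InBranch p0 z) →
    count P? (forestPos i ts) ≡ 0
  count-before-branch i ts p0 p0<i inBranch = count-none P? (forestPos i ts) absurd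
    where
    absurd : ∀ z → z ∈ forestPos i ts → ¬ P z
    absurd z z∈ pz with inBranch z z∈ pz | forestPos-head i ts z z∈
    ... | _ , refl | _ , _ , refl , i≤p0 = <⇒≱ p0<i i≤p0

  tail-in-branch : ∀ {i t ts p0} → (∀ z → z ∈ forestPos i (t ∷ ts) → P z → InBranch p0 z) →
    ∀ z → z ∈ forestPos (suc i) ts → P z → InBranch p0 z
  tail-in-branch {i} {t} inBranch z z∈ = inBranch z (∈-++⁺ʳ (map (i ∷_) (positions t)) z∈)

  head-outside-branch : ∀ {i t ts p0} → (∀ z → z ∈ forestPos i (t ∷ ts) → P z → InBranch p0 z) →
    ¬ i ≡ p0 → ∀ u → u ∈ positions t → ¬ P (i ∷ u)
  head-outside-branch {i} inBranch i≢p0 u u∈ pu with inBranch (i ∷ u) (∈-++⁺ˡ (∈-map⁺ (i ∷_) u∈)) pu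
  ... | _ , refl = i≢p0 refl

  count-in-branch : ∀ i ts p0 → (∀ z → z ∈ forestPos i ts → P z → InBranch p0 z) →
    count P? (forestPos i ts) ≤ count (λ u → P? (p0 ∷ u)) (positions (branch ts (p0 ∸ i)))
  count-in-branch i [] p0 _ = z≤n
  count-in-branch i (t ∷ ts) p0 inBranch
    rewrite count-++ P? (map (i ∷_) (positions t)) (forestPos (suc i) ts)
          | count-map P? (i ∷_) (positions t)
    with <-cmp i p0
  ... | tri≈ _ refl _
    rewrite n∸n≡0 i | count-before-branch (suc i) ts i ≤-refl (tail-in-branch {i} {t} {ts} inBranch) =
    ≤-reflexive (+-identityʳ _)
  ... | tri< i<p0 i≢p0 _
    rewrite count-none (λ u → P? (i ∷ u)) (positions t) (head-outside-branch {i} {t} {ts} inBranch i≢p0) | +-∸-assoc 1 i<p0 =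
    count-in-branch (suc i) ts p0 (tail-in-branch {i} {t} {ts} inBranch)
  ... | tri> _ i≢p0 p0<i
    rewrite count-none (λ u → P? (i ∷ u)) (positions t) (head-outside-branch {i} {t} {ts} inBranch i≢p0)
          | count-before-branch (suc i) ts p0 (m≤n⇒m≤1+n p0<i) (tail-in-branch {i} {t} {ts} inBranch) = z≤n

module Central (ℓ : ℕ) where

  central⇒near : ∀ x z → ecc x z ≤ ℓ → All (λ u → dist z u ≤ ℓ) (positions x)
  central⇒near x z = max≤⇒All≤ ℓ (dist z) (positions x)

  near⇒central : ∀ x z → All (λ u → dist z u ≤ ℓ) (positions x) → ecc x z ≤ ℓ
  near⇒central x z = All≤⇒max≤ ℓ (dist z) (positions x)

  central⇒height≤ : ∀ x z → ecc x z ≤ ℓ → length z ≤ ℓ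
  central⇒height≤ x z central = subst (_≤ ℓ) (dist-root z) (lookup (central⇒near x z central) (root-position x))

  centralAt? : ∀ k x z → Dec (length z ≡ k × ecc x z ≤ ℓ)
  centralAt? k x z = (length z ≟ k) ×-dec (ecc x z ≤? ℓ)

  centralAt : ℕ → Tree → ℕ
  centralAt k x = atHeight (λ z → ecc x z ≤? ℓ) k (positions x)

  centralAt≤width : ∀ k x → centralAt k x ≤ width k x
  centralAt≤width k x = count-mono _ (λ z → length z ≟ k) (positions x) (λ _ _ → proj₁)

  width≤centralAt : ∀ k x → All (λ u → length u + k ≤ ℓ) (positions x) → width k x ≤ centralAt k x
  width≤centralAt k x shallow = count-mono _ _ (positions x) λ z _ z-at-k →
    z-at-k , near⇒central x z (tabulate λ {u} u∈x → ≤-trans (dist-≤ z u)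
      (subst (_≤ ℓ) (trans (+-comm (length u) k) (cong (_+ length u) (sym z-at-k))) (lookup shallow u∈x)))

  centralAt-root-far : ∀ x v → v ∈ positions x → ℓ < length v → centralAt 0 x ≡ 0
  centralAt-root-far x v v∈x far = count-none _ (positions x) λ { [] _ (_ , central) →
    <⇒≱ far (lookup (central⇒near x [] central) v∈x) }

  centralAt-too-deep : ∀ k x → ℓ < k → centralAt k x ≡ 0
  centralAt-too-deep k x ℓ<k = count-none _ (positions x) λ { z _ (refl , central) →
    <⇒≱ ℓ<k (central⇒height≤ x z central) }

  same-branch : ∀ x i a j b → ecc x (i ∷ a) ≤ ℓ → j ∷ b ∈ positions x →
    ℓ < length (i ∷ a) + length (j ∷ b) → i ≡ j
  same-branch x i a j b central jb∈x far with i ≟ j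
  ... | yes i≡j = i≡j
  ... | no i≢j = ⊥-elim (<⇒≱ far
    (subst (_≤ ℓ) (dist-other-branch i j a b i≢j) (lookup (central⇒near x (i ∷ a) central) jb∈x)))

  central-in-branch : ∀ ts k p0 v → p0 ∷ v ∈ positions (node ts) → ℓ < length (p0 ∷ v) + suc k →
    ∀ z → z ∈ forestPos 0 ts → length z ≡ suc k × ecc (node ts) z ≤ ℓ → InBranch p0 z
  central-in-branch ts k p0 v v∈ far z z∈ (z-at , central) with forestPos-view 0 ts z z∈
  ... | p , u , refl , _ = u , cong (_∷ u) (same-branch (node ts) p u p0 v central v∈ far′)
    where
    far′ : ℓ < length (p ∷ u) + length (p0 ∷ v)
    far′ = subst (ℓ <_) (trans (+-comm _ (suc k)) (cong (_+ length (p0 ∷ v)) (sym z-at))) far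

  centralAt-branch : ∀ ts k p0 v → p0 ∷ v ∈ positions (node ts) → ℓ < length (p0 ∷ v) + suc k →
    centralAt (suc k) (node ts) ≤ centralAt k (branch ts p0)
  centralAt-branch ts k p0 v v∈ far = begin
    centralAt (suc k) (node ts)
      ≡⟨ count-skip C? [] (forestPos 0 ts) (λ ()) ⟩
    count C? (forestPos 0 ts)
      ≤⟨ count-in-branch C? 0 ts p0 (central-in-branch ts k p0 v v∈ far) ⟩
    count (λ u → C? (p0 ∷ u)) (positions (branch ts p0))
      ≤⟨ count-mono _ _ (positions (branch ts p0)) restrict ⟩
    centralAt k (branch ts p0) ∎
    where
    open ≤-Reasoning
    C? = centralAt? (suc k) (node ts)
    restrict : ∀ u → u ∈ positions (branch ts p0) → length (p0 ∷ u) ≡ suc k × ecc (node ts) (p0 ∷ u) ≤ ℓ →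
      length u ≡ k × ecc (branch ts p0) u ≤ ℓ
    restrict u _ (u-at , central) = suc-injective u-at , near⇒central (branch ts p0) u (tabulate λ {u'} u'∈ →
      subst (_≤ ℓ) (dist-same-branch p0 u u')
        (lookup (central⇒near (node ts) (p0 ∷ u) central) (position-branch ts p0 u' (proj₁ (position-branch⁻ ts p0 v v∈)) u'∈)))

  width-branch-deep : ∀ ts k p0 c → ecc (node ts) (p0 ∷ c) ≤ ℓ → length c ≡ k →
    ∀ r → ℓ ≤ r + suc k → width (suc r) (node ts) ≤ width r (branch ts p0)
  width-branch-deep ts k p0 c central c-at r deep = begin
    width (suc r) (node ts)
      ≡⟨ count-skip (λ z → length z ≟ suc r) [] (forestPos 0 ts) (λ ()) ⟩
    count (λ z → length z ≟ suc r) (forestPos 0 ts)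
      ≤⟨ count-in-branch _ 0 ts p0 in-branch ⟩
    count (λ u → length (p0 ∷ u) ≟ suc r) (positions (branch ts p0))
      ≤⟨ count-mono _ _ (positions (branch ts p0)) (λ _ _ → suc-injective) ⟩
    width r (branch ts p0) ∎
    where
    open ≤-Reasoning
    in-branch : ∀ y → y ∈ forestPos 0 ts → length y ≡ suc r → InBranch p0 y
    in-branch y y∈ y-at with forestPos-view 0 ts y y∈
    ... | p , u , refl , _ = u , cong (_∷ u) (sym (same-branch (node ts) p0 c p u central (there y∈) far))
      where
      far : ℓ < length (p0 ∷ c) + length (p ∷ u)
      far = subst₂ (λ a b → ℓ < suc a + b) (sym c-at) (sym y-at)
        (≤-<-trans (subst (ℓ ≤_) (+-comm r (suc k)) deep) (+-monoʳ-< (suc k) (n<1+n r)))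

  centralAt-leftmost : ∀ g₀ gs k → suc k ≤ ℓ →
    (∀ p u → p < length gs → u ∈ positions (branch gs p) → length u + suc k < ℓ) →
    centralAt k g₀ ≤ centralAt (suc k) (node (g₀ ∷ gs))
  centralAt-leftmost g₀ gs k k<ℓ shallow = begin
    centralAt k g₀
      ≤⟨ count-mono _ (λ u → C? (0 ∷ u)) (positions g₀) (λ z _ → lift z) ⟩
    count (λ u → C? (0 ∷ u)) (positions g₀)
      ≡⟨ count-map C? (0 ∷_) (positions g₀) ⟨
    count C? (map (0 ∷_) (positions g₀))
      ≤⟨ m≤m+n _ _ ⟩
    count C? (map (0 ∷_) (positions g₀)) + count C? (forestPos 1 gs)
      ≡⟨ count-++ C? (map (0 ∷_) (positions g₀)) (forestPos 1 gs) ⟨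
    count C? (forestPos 0 (g₀ ∷ gs))
      ≤⟨ count-∷-≥ C? [] (forestPos 0 (g₀ ∷ gs)) ⟩
    centralAt (suc k) (node (g₀ ∷ gs)) ∎
    where
    open ≤-Reasoning
    g = node (g₀ ∷ gs)
    C? = centralAt? (suc k) g
    lift : ∀ z → length z ≡ k × ecc g₀ z ≤ ℓ → length (0 ∷ z) ≡ suc k × ecc g (0 ∷ z) ≤ ℓ
    lift z (refl , central) = refl , near⇒central g (0 ∷ z) (tabulate near)
      where
      near : ∀ {y} → y ∈ positions g → dist (0 ∷ z) y ≤ ℓ
      near (here refl) = subst (_≤ ℓ) (sym (dist-root (0 ∷ z))) k<ℓ
      near (there y∈) with ∈-++⁻ (map (0 ∷_) (positions g₀)) y∈
      ... | inj₁ y∈g₀ with ∈-map⁻ (0 ∷_) y∈g₀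
      ...   | u , u∈ , refl = subst (_≤ ℓ) (sym (dist-same-branch 0 z u)) (lookup (central⇒near g₀ z central) u∈)
      near (there y∈) | inj₂ y∈gs with forestPos-view 1 gs _ y∈gs
      ...   | p , u , refl , p<len , u∈ = subst (_≤ ℓ) (sym (trans (dist-other-branch 0 (suc p) z u (λ ()))
                (+-comm (suc (length z)) (suc (length u))))) (shallow p u p<len u∈)

mutual
  Dominated : Tree → Tree → Set
  Dominated (node xs) g = (∀ r → width r (node xs) ≤ width r g) × AllDominated xs (headTree (subtrees g))

  AllDominated : List Tree → Tree → Set
  AllDominated [] g = ⊤
  AllDominated (x ∷ xs) g = Dominated x g × AllDominated xs g

Dominated⇒width≤ : ∀ w g → Dominated w g → ∀ r → width r w ≤ width r g
Dominated⇒width≤ (node xs) g = proj₁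

Dominated-branch : ∀ ts g p → Dominated (node ts) g → p < length ts → Dominated (branch ts p) (headTree (subtrees g))
Dominated-branch ts g p (_ , all) = lookupDominated ts p all
  where
  lookupDominated : ∀ ts p → AllDominated ts (headTree (subtrees g)) → p < length ts →
    Dominated (branch ts p) (headTree (subtrees g))
  lookupDominated (t ∷ ts) zero (d , _) _ = d
  lookupDominated (t ∷ ts) (suc p) (_ , ds) (s≤s p<len) = lookupDominated ts p ds p<len

module Comparison (ℓ : ℕ) where
  open Central ℓ

  DeepWider : ℕ → Tree → Tree → Set
  DeepWider k w g = ∀ r → ℓ ≤ r + k → width r g ≤ width r w

  deep-counterpart : ∀ k w g → DeepWider k w g → ∀ u → u ∈ positions g → ℓ < length u + k →
    ∃[ v ] (v ∈ positions w × length v ≡ length u)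
  deep-counterpart k w g deep u u∈g u-deep = count-witness (λ z → length z ≟ length u) (positions w)
    (≤-trans (count-member (λ z → length z ≟ length u) (positions g) u u∈g refl) (deep (length u) (<⇒≤ u-deep)))

  others-shallow : ∀ g₀ gs k → (∀ r → ℓ ≤ r + suc k → width (suc r) (node (g₀ ∷ gs)) ≤ width r g₀) →
    ∀ p u → p < length gs → u ∈ positions (branch gs p) → length u + suc k < ℓ
  others-shallow g₀ gs k narrow p u p<len u∈ with length u + suc k <? ℓ
  ... | yes shallow = shallow
  ... | no ¬shallow = ⊥-elim (<⇒≱ too-wide (narrow r (≮⇒≥ ¬shallow)))
    where
    r = length u
    too-wide : width r g₀ < width (suc r) (node (g₀ ∷ gs))
    too-wide = <-≤-trans (subst (_≤ width r g₀ + width r (branch gs p)) (+-comm (width r g₀) 1)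
                 (+-monoʳ-≤ (width r g₀) (count-member _ (positions (branch gs p)) u u∈ refl)))
               (width-two-branches g₀ gs p r p<len)

  mutual
    compare : ∀ k w g → Dominated w g → DeepWider k w g → centralAt k w ≤ centralAt k g
    compare k w g dom deep with all? (λ u → length u + k ≤? ℓ) (positions g)
    ... | yes shallow =
      ≤-trans (centralAt≤width k w) (≤-trans (Dominated⇒width≤ w g dom k) (width≤centralAt k g shallow))
    ... | no ¬shallow with find (¬All⇒Any¬ (λ u → length u + k ≤? ℓ) (positions g) ¬shallow)
    ...   | u , u∈g , u-deep = compare-deep k w g dom deep u u∈g (≰⇒> u-deep)

    compare-deep : ∀ k w g → Dominated w g → DeepWider k w g → ∀ u → u ∈ positions g → ℓ < length u + k →
      centralAt k w ≤ centralAt k g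
    compare-deep zero w g dom deep u u∈g u-deep with deep-counterpart zero w g deep u u∈g u-deep
    ... | v , v∈w , v-at = ≤-trans (≤-reflexive (centralAt-root-far w v v∈w
      (subst (ℓ <_) (trans (+-identityʳ (length u)) (sym v-at)) u-deep))) z≤n
    compare-deep (suc k) w g dom deep u u∈g u-deep with suc k ≤? ℓ
    ... | no k>ℓ = ≤-trans (≤-reflexive (centralAt-too-deep (suc k) w (≰⇒> k>ℓ))) z≤n
    ... | yes k≤ℓ with deep-counterpart (suc k) w g deep u u∈g u-deep
    ...   | [] , _ , v-at = ⊥-elim (<⇒≱ (subst (λ h → ℓ < h + suc k) (sym v-at) u-deep) k≤ℓ)
    ...   | p0 ∷ v , v∈w , v-at =
      compare-branch k w g dom deep p0 v v∈w (subst (λ h → ℓ < h + suc k) (sym v-at) u-deep) u u∈g u-deep k≤ℓ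

    -- both w and g have deep vertices and k + 1 ≤ ℓ: pass to the branch of w
    -- containing the deep vertex p0 ∷ v and the leftmost branch of g
    compare-branch : ∀ k w g → Dominated w g → DeepWider (suc k) w g →
      ∀ p0 v → p0 ∷ v ∈ positions w → ℓ < length (p0 ∷ v) + suc k →
      ∀ u → u ∈ positions g → ℓ < length u + suc k → suc k ≤ ℓ → centralAt (suc k) w ≤ centralAt (suc k) g
    compare-branch k w (node []) _ _ _ _ _ _ .[] (here refl) u-deep k≤ℓ = ⊥-elim (<⇒≱ u-deep k≤ℓ)
    compare-branch k (node ts) g@(node (g₀ ∷ gs)) dom deep p0 v v∈w far _ _ _ k≤ℓ
      with centralAt (suc k) (node ts) ≟ 0
    ... | yes none = ≤-trans (≤-reflexive none) z≤n
    ... | no some with count-witness (centralAt? (suc k) (node ts)) (positions (node ts)) (n≢0⇒n>0 some)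
    ...   | _ , here refl , (() , _)
    ...   | z , there z∈ , z-central with central-in-branch ts k p0 v v∈w far z z∈ z-central
    ...     | c , refl = begin
      centralAt (suc k) (node ts)  ≤⟨ centralAt-branch ts k p0 v v∈w far ⟩
      centralAt k B                ≤⟨ compare k B g₀ domB deepB ⟩
      centralAt k g₀               ≤⟨ centralAt-leftmost g₀ gs k k≤ℓ (others-shallow g₀ gs k narrow) ⟩
      centralAt (suc k) g          ∎
      where
      open ≤-Reasoning
      B = branch ts p0
      domB : Dominated B g₀
      domB = Dominated-branch ts g p0 dom (proj₁ (position-branch⁻ ts p0 v v∈w))
      into-B : ∀ r → ℓ ≤ r + suc k → width (suc r) (node ts) ≤ width r B
      into-B = width-branch-deep ts k p0 c (proj₂ z-central) (suc-injective (proj₁ z-central))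
      deepB : DeepWider k B g₀
      deepB r shallower = begin
        width r g₀               ≤⟨ width-branch (g₀ ∷ gs) 0 r (s≤s z≤n) ⟩
        width (suc r) g          ≤⟨ deep (suc r) (m≤n⇒m≤1+n deeper) ⟩
        width (suc r) (node ts)  ≤⟨ into-B r deeper ⟩
        width r B                ∎
        where
        deeper : ℓ ≤ r + suc k
        deeper = ≤-trans shallower (+-monoʳ-≤ r (n≤1+n k))
      narrow : ∀ r → ℓ ≤ r + suc k → width (suc r) g ≤ width r g₀
      narrow r deeper = begin
        width (suc r) g          ≤⟨ deep (suc r) (m≤n⇒m≤1+n deeper) ⟩
        width (suc r) (node ts)  ≤⟨ into-B r deeper ⟩
        width r B                ≤⟨ Dominated⇒width≤ B g₀ domB r ⟩
        width r g₀               ∎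

sortDesc-↭ : ∀ xs → sortDesc xs ↭ xs
sortDesc-↭ xs = ↭-trans (↭-reverse (sort xs)) (sort-↭ xs)

reverse-nonincreasing : ∀ {xs : List ℕ} → AllPairs _≤_ xs → AllPairs _≥_ (reverse xs)
reverse-nonincreasing {[]} [] = []
reverse-nonincreasing {x ∷ xs} (x≤xs ∷ xs↗) rewrite unfold-reverse x xs =
  AllPairs.++⁺ (reverse-nonincreasing xs↗) ([] ∷ []) (tabulate λ y∈ → lookup x≤xs (∈-resp-↭ (↭-reverse xs) y∈) ∷ [])

sortDesc-nonincreasing : ∀ xs → AllPairs _≥_ (sortDesc xs)
sortDesc-nonincreasing xs = reverse-nonincreasing (Linked⇒AllPairs ≤-trans (sort-↗ xs))

SubMultiset : List ℕ → List ℕ → Set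
SubMultiset xs ys = Σ (List ℕ) (λ rest → xs ++ rest ↭ ys)

SubMultiset-++ˡ : ∀ a b ys → SubMultiset (a ++ b) ys → SubMultiset a ys
SubMultiset-++ˡ a b ys (rest , p) = b ++ rest , subst (_↭ ys) (++-assoc a b rest) p

SubMultiset-++ʳ : ∀ a b ys → SubMultiset (a ++ b) ys → SubMultiset b ys
SubMultiset-++ʳ a b ys (rest , p) = a ++ rest ,
  ↭-trans (subst (_↭ (a ++ b) ++ rest) (++-assoc b a rest) (++⁺ʳ rest (++-comm b a))) p

SubMultiset-length : ∀ xs ys → SubMultiset xs ys → length xs ≤ length ys
SubMultiset-length xs ys (rest , p) = ≤-trans (m≤m+n _ _) (≤-reflexive (trans (sym (length-++ xs)) (↭-length p)))

prefix-sum-cons : ∀ d (L : List ℕ) m → All (_≤ d) L → sum (take m L) ≤ sum (take m (d ∷ L))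
prefix-sum-cons d L zero _ = z≤n
prefix-sum-cons d L (suc m) L≤d = shift-bound L m L≤d
  where
  shift-bound : ∀ L m → All (_≤ d) L → sum (take (suc m) L) ≤ d + sum (take m L)
  shift-bound [] m _ = z≤n
  shift-bound (e ∷ E) zero (e≤d ∷ _) = +-monoˡ-≤ 0 e≤d
  shift-bound (e ∷ E) (suc m) (_ ∷ E≤d) = begin
    e + sum (take (suc m) E)    ≤⟨ +-monoʳ-≤ e (shift-bound E m E≤d) ⟩
    e + (d + sum (take m E))    ≡⟨ x∙yz≈y∙xz e d _ ⟩
    d + (e + sum (take m E))    ∎
    where open ≤-Reasoning

drop-middle : ∀ {d : ℕ} {D} a b rest → (a ++ d ∷ b) ++ rest ↭ d ∷ D → (a ++ b) ++ rest ↭ D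
drop-middle {d} a b rest p = drop-∷ (↭-trans (begin
  d ∷ (a ++ b) ++ rest     ≡⟨ cong (d ∷_) (++-assoc a b rest) ⟩
  d ∷ a ++ b ++ rest       ↭⟨ shift d a (b ++ rest) ⟨
  a ++ d ∷ b ++ rest       ≡⟨ ++-assoc a (d ∷ b) rest ⟨
  (a ++ d ∷ b) ++ rest     ∎) p)
  where open PermutationReasoning

sum≤prefix-sum : ∀ D → AllPairs _≥_ D → ∀ xs → SubMultiset xs D → sum xs ≤ sum (take (length xs) D)
sum≤prefix-sum [] _ xs (rest , p) with ↭-empty-inv p
sum≤prefix-sum [] _ [] (rest , p) | _ = z≤n
sum≤prefix-sum (d ∷ D) (d≥D ∷ D↘) xs (rest , p) with ∈-++⁻ xs (∈-resp-↭ (↭-sym p) (here refl))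
... | inj₁ d∈xs with ∈-∃++ d∈xs
...   | a , b , refl = begin
  sum (a ++ d ∷ b)                       ≡⟨ sum-↭ (shift d a b) ⟩
  d + sum (a ++ b)                       ≤⟨ +-monoʳ-≤ d (sum≤prefix-sum D D↘ (a ++ b) (rest , drop-middle a b rest p)) ⟩
  d + sum (take (length (a ++ b)) D)     ≡⟨ cong (λ n → sum (take n (d ∷ D))) (↭-length (shift d a b)) ⟨
  sum (take (length (a ++ d ∷ b)) (d ∷ D)) ∎
  where
  open ≤-Reasoning
sum≤prefix-sum (d ∷ D) (d≥D ∷ D↘) xs (rest , p) | inj₂ d∈rest with ∈-∃++ d∈rest
... | a , b , refl =
  ≤-trans (sum≤prefix-sum D D↘ xs (a ++ b , rest-perm)) (prefix-sum-cons d D (length xs) d≥D)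
  where
  rest-perm : xs ++ a ++ b ↭ D
  rest-perm = drop-∷ (↭-trans (↭-sym (↭-trans (++⁺ˡ xs (shift d a b)) (shift d xs (a ++ b)))) p)

length-assign : ∀ ds fs → length (assign ds fs) ≡ length ds
length-assign [] fs = refl
length-assign (d ∷ ds) fs = cong suc (length-assign ds (drop d fs))

take-assign : ∀ m ds fs → take m (assign ds fs) ≡ assign (take m ds) fs
take-assign zero ds fs = refl
take-assign (suc m) [] fs = refl
take-assign (suc m) (d ∷ ds) fs = cong (node (take d fs) ∷_) (take-assign m ds (drop d fs))

take-++-take-drop : ∀ a b (xs : List Tree) → take a xs ++ take b (drop a xs) ≡ take (a + b) xs
take-++-take-drop zero b xs = refl
take-++-take-drop (suc a) zero [] = refl
take-++-take-drop (suc a) (suc b) [] = refl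
take-++-take-drop (suc a) b (x ∷ xs) = cong (x ∷_) (take-++-take-drop a b xs)

children-assign : ∀ ds fs → children (assign ds fs) ≡ take (sum ds) fs
children-assign [] fs = refl
children-assign (d ∷ ds) fs =
  trans (cong (take d fs ++_) (children-assign ds (drop d fs))) (take-++-take-drop d (sum ds) fs)

map-down-assign : ∀ ds fs → sum ds ≤ length fs → map down (assign ds fs) ≡ ds
map-down-assign [] fs _ = refl
map-down-assign (d ∷ ds) fs enough = cong₂ _∷_
  (trans (length-take d fs) (m≤n⇒m⊓n≡m (≤-trans (m≤m+n d (sum ds)) enough)))
  (map-down-assign ds (drop d fs)
    (subst (sum ds ≤_) (sym (length-drop d fs)) (m+n≤o⇒m≤o∸n (sum ds) (subst (_≤ length fs) (+-comm d (sum ds)) enough))))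

first-child-assign : ∀ ds fs → 1 ≤ down (headTree (assign ds fs)) → headTree (subtrees (headTree (assign ds fs))) ≡ headTree fs
first-child-assign (suc d ∷ ds) (f ∷ fs) _ = refl
first-child-assign (zero ∷ ds) fs ()
first-child-assign (suc d ∷ ds) [] ()

buildLevels-drop : ∀ (L : List (List ℕ)) r → buildLevels (drop r L) ≡ assign (entry L r) (buildLevels (drop (suc r) L))
buildLevels-drop [] zero = refl
buildLevels-drop [] (suc r) = refl
buildLevels-drop (l ∷ L) zero = refl
buildLevels-drop (l ∷ L) (suc r) = buildLevels-drop L r

prefix-width-mono : ∀ a b (F : List Tree) j → a ≤ b → length (downAt (take a F) j) ≤ length (downAt (take b F) j)
prefix-width-mono a b F j a≤b = begin
  length (downAt (take a F) j)                      ≡⟨ cong (λ X → length (downAt X j)) prefix ⟨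
  length (downAt front j)                           ≤⟨ m≤m+n _ _ ⟩
  length (downAt front j) + length (downAt back j)  ≡⟨ length-++ (downAt front j) ⟨
  length (downAt front j ++ downAt back j)          ≡⟨ cong length (downAt-++ front back j) ⟨
  length (downAt (front ++ back) j)                 ≡⟨ cong (λ X → length (downAt X j)) (take++drop≡id a (take b F)) ⟩
  length (downAt (take b F) j)                      ∎
  where
  open ≤-Reasoning
  front back : List Tree
  front = take a (take b F)
  back = drop a (take b F)
  prefix : front ≡ take a F
  prefix = trans (take-take a b F) (cong (λ n → take n F) (m≤n⇒m⊓n≡m a≤b))

module Greedy (L : List (List ℕ)) (nonincreasing : ∀ r → AllPairs _≥_ (entry L r)) where

  degs : ℕ → List ℕ
  degs = entry L

  forest : ℕ → List Tree
  forest r = buildLevels (drop r L)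

  forest-suc : ∀ r → forest r ≡ assign (degs r) (forest (suc r))
  forest-suc = buildLevels-drop L

  length-forest : ∀ r → length (forest r) ≡ length (degs r)
  length-forest r = trans (cong length (forest-suc r)) (length-assign (degs r) (forest (suc r)))

  FitsFrom : ℕ → List Tree → Set
  FitsFrom r X = ∀ j → SubMultiset (downAt X j) (degs (r + j))

  fits-here : ∀ r X → FitsFrom r X → SubMultiset (map down X) (degs r)
  fits-here r X fits = subst (λ n → SubMultiset (map down X) (degs n)) (+-identityʳ r) (fits 0)

  fits-below : ∀ r X → FitsFrom r X → FitsFrom (suc r) (children X)
  fits-below r X fits j = subst (λ n → SubMultiset (downAt (children X) j) (degs n)) (+-suc r j) (fits (suc j))

  fits-length : ∀ r X → FitsFrom r X → length X ≤ length (forest r)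
  fits-length r X fits = subst₂ _≤_ (length-map down X) (sym (length-forest r))
    (SubMultiset-length (map down X) (degs r) (fits-here r X fits))

  -- the first |X| greedy trees at height r are at least as wide as X on
  -- every level, since greedy vertices take their children left to right
  -- and the largest down-degrees come first
  prefix-widest : ∀ j r X → FitsFrom r X → length (downAt X j) ≤ length (downAt (take (length X) (forest r)) j)
  prefix-widest zero r X fits = begin
    length (map down X)                            ≡⟨ length-map down X ⟩
    length X                                       ≡⟨ m≤n⇒m⊓n≡m (fits-length r X fits) ⟨
    length X ⊓ length (forest r)                   ≡⟨ length-take (length X) (forest r) ⟨
    length (take (length X) (forest r))            ≡⟨ length-map down (take (length X) (forest r)) ⟨
    length (map down (take (length X) (forest r))) ∎
    where open ≤-Reasoning
  prefix-widest (suc j) r X fits = begin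
    length (downAt (children X) j)
      ≤⟨ prefix-widest j (suc r) (children X) (fits-below r X fits) ⟩
    length (downAt (take (length (children X)) (forest (suc r))) j)
      ≤⟨ prefix-width-mono _ _ (forest (suc r)) j few-children ⟩
    length (downAt (take (sum (take (length X) (degs r))) (forest (suc r))) j)
      ≡⟨ cong (λ F → length (downAt F j)) greedy-children ⟨
    length (downAt (children (take (length X) (forest r))) j) ∎
    where
    open ≤-Reasoning
    few-children : length (children X) ≤ sum (take (length X) (degs r))
    few-children = subst₂ _≤_ (sym (length-children X)) (cong (λ n → sum (take n (degs r))) (length-map down X))
      (sum≤prefix-sum (degs r) (nonincreasing r) (map down X) (fits-here r X fits))
    greedy-children : children (take (length X) (forest r)) ≡ take (sum (take (length X) (degs r))) (forest (suc r))
    greedy-children = trans (cong (λ F → children (take (length X) F)) (forest-suc r))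
      (trans (cong children (take-assign (length X) (degs r) (forest (suc r))))
        (children-assign (take (length X) (degs r)) (forest (suc r))))

  leftmost-child : ∀ r → 1 ≤ down (headTree (forest r)) → headTree (subtrees (headTree (forest r))) ≡ headTree (forest (suc r))
  leftmost-child r = subst (λ F → 1 ≤ down (headTree F) → headTree (subtrees (headTree F)) ≡ headTree (forest (suc r)))
    (sym (forest-suc r)) (first-child-assign (degs r) (forest (suc r)))

  greedy-widths : ∀ x r → FitsFrom r (x ∷ []) → ∀ j → width j x ≤ width j (headTree (forest r))
  greedy-widths x r fits j = subst₂ _≤_ (sym (width≡length-levels x j))
    (trans (cong (λ F → length (downAt F j)) leftmost) (sym (width≡length-levels (headTree (forest r)) j)))
    (prefix-widest j r (x ∷ []) fits)
    where
    leftmost : take 1 (forest r) ≡ headTree (forest r) ∷ []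
    leftmost with forest r | fits-length r (x ∷ []) fits
    ... | f ∷ _ | _ = refl

  mutual
    greedy-dominates : ∀ x r → FitsFrom r (x ∷ []) → Dominated x (headTree (forest r))
    greedy-dominates (node []) r fits = greedy-widths (node []) r fits , tt
    greedy-dominates (node (y ∷ ys)) r fits =
      greedy-widths (node (y ∷ ys)) r fits ,
      subst (AllDominated (y ∷ ys)) (sym (leftmost-child r has-child))
        (all-dominated (y ∷ ys) (suc r) (λ j → subst₂ (λ X n → SubMultiset (downAt X j) (degs n))
          (++-identityʳ (y ∷ ys)) (+-suc r j) (fits (suc j))))
      where
      has-child : 1 ≤ down (headTree (forest r))
      has-child = subst (1 ≤_) (width-one (headTree (forest r)))
        (≤-trans (subst (1 ≤_) (sym (width-one (node (y ∷ ys)))) (s≤s z≤n)) (greedy-widths (node (y ∷ ys)) r fits 1))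

    all-dominated : ∀ xs r → FitsFrom r xs → AllDominated xs (headTree (forest r))
    all-dominated [] r fits = tt
    all-dominated (x ∷ xs) r fits =
      greedy-dominates x r (λ j → SubMultiset-++ˡ (levels x j) (downAt xs j) _ (split j)) ,
      all-dominated xs r (λ j → SubMultiset-++ʳ (levels x j) (downAt xs j) _ (split j))
      where
      split : ∀ j → SubMultiset (levels x j ++ downAt xs j) (degs (r + j))
      split j = subst (λ X → SubMultiset X _) (downAt-++ (x ∷ []) xs j) (fits j)

toDown-degLevels : ∀ T₀ → toDown (degLevels T₀) ≡ downLevels T₀
toDown-degLevels (node ts) = cong ((length ts ∷ []) ∷_) (map-pred-suc-levels (forestLevels ts))
  where
  map-pred-suc-levels : ∀ (L : List (List ℕ)) → map (map pred) (map (map suc) L) ≡ L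
  map-pred-suc-levels [] = refl
  map-pred-suc-levels (l ∷ L) = cong₂ _∷_ (map-pred-suc l) (map-pred-suc-levels L)

entry-map-sortDesc : ∀ L r → entry (map sortDesc L) r ≡ sortDesc (entry L r)
entry-map-sortDesc [] r = refl
entry-map-sortDesc (l ∷ L) zero = refl
entry-map-sortDesc (l ∷ L) (suc r) = entry-map-sortDesc L r

module GreedyTree (T₀ : Tree) where

  sorted : List (List ℕ)
  sorted = map sortDesc (toDown (degLevels T₀))

  sorted-entry : ∀ r → entry sorted r ≡ sortDesc (levels T₀ r)
  sorted-entry r = trans (entry-map-sortDesc (toDown (degLevels T₀)) r)
    (cong sortDesc (trans (cong (λ L → entry L r) (toDown-degLevels T₀)) (entry-downLevels T₀ r)))

  open Greedy sorted (λ r → subst (AllPairs _≥_) (sym (sorted-entry r)) (sortDesc-nonincreasing (levels T₀ r)))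

  degs↭levels : ∀ r → degs r ↭ levels T₀ r
  degs↭levels r = subst (_↭ levels T₀ r) (sym (sorted-entry r)) (sortDesc-↭ (levels T₀ r))

  sum-degs : ∀ r → sum (degs r) ≡ length (degs (suc r))
  sum-degs r = trans (sum-↭ (degs↭levels r)) (trans (sum-downAt (T₀ ∷ []) r) (sym (↭-length (degs↭levels (suc r)))))

  downAt-forest : ∀ j r → downAt (forest r) j ≡ degs (r + j)
  downAt-forest zero r = begin
    map down (forest r)                                ≡⟨ cong (map down) (forest-suc r) ⟩
    map down (assign (degs r) (forest (suc r)))        ≡⟨ map-down-assign (degs r) (forest (suc r)) enough ⟩
    degs r                                             ≡⟨ cong degs (+-identityʳ r) ⟨
    degs (r + 0)                                       ∎
    where
    open ≡-Reasoning
    enough : sum (degs r) ≤ length (forest (suc r))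
    enough = ≤-reflexive (trans (sum-degs r) (sym (length-forest (suc r))))
  downAt-forest (suc j) r = begin
    downAt (children (forest r)) j
      ≡⟨ cong (λ F → downAt (children F) j) (forest-suc r) ⟩
    downAt (children (assign (degs r) (forest (suc r)))) j
      ≡⟨ cong (λ F → downAt F j) (children-assign (degs r) (forest (suc r))) ⟩
    downAt (take (sum (degs r)) (forest (suc r))) j
      ≡⟨ cong (λ F → downAt F j) (take-all (sum (degs r)) (forest (suc r)) all) ⟩
    downAt (forest (suc r)) j
      ≡⟨ downAt-forest j (suc r) ⟩
    degs (suc r + j)
      ≡⟨ cong degs (+-suc r j) ⟨
    degs (r + suc j) ∎
    where
    open ≡-Reasoning
    all : length (forest (suc r)) ≤ sum (degs r)
    all = ≤-reflexive (trans (length-forest (suc r)) (sym (sum-degs r)))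

  G : Tree
  G = greedy (degLevels T₀)

  forest-root : forest 0 ≡ G ∷ []
  forest-root with forest 0 | trans (length-forest 0) (↭-length (degs↭levels 0))
  ... | t ∷ [] | _ = refl

  greedy-sameLevels : ∀ r → levels G r ↭ levels T₀ r
  greedy-sameLevels r = subst (_↭ levels T₀ r) (sym (trans (cong (λ F → downAt F r) (sym forest-root)) (downAt-forest r 0)))
    (degs↭levels r)

  greedy-dominates-same : ∀ T → (∀ r → levels T r ↭ levels T₀ r) → Dominated T G
  greedy-dominates-same T same = greedy-dominates T 0
    (λ j → [] , subst (_↭ degs j) (sym (++-identityʳ (levels T j))) (↭-trans (same j) (↭-sym (degs↭levels j))))

-- every central vertex has height less than ℓ + 1, so countEccLe counts below height ℓ + 1
countEccLe≡below : ∀ ℓ x → countEccLe ℓ x ≡ below (λ z → ecc x z ≤? ℓ) (suc ℓ) (positions x)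
countEccLe≡below ℓ x = trans (length-filter≡count _ (positions x))
  (count-cong _ _ (positions x) (λ z central → s≤s (central⇒height≤ x z central) , central) (λ _ → proj₂))
  where open Central ℓ

lemma3p7 : (ℓ : ℕ) (T₀ : Tree) →
    Pointwise _↭_ (degLevels (greedy (degLevels T₀))) (degLevels T₀)
    × ((T : Tree) → Pointwise _↭_ (degLevels T) (degLevels T₀) →
        countEccLe ℓ T ≤ countEccLe ℓ (greedy (degLevels T₀)))
lemma3p7 ℓ T₀ = sameLevels⇒sameDegLevels G T₀ greedy-sameLevels , more-central
  where
  open GreedyTree T₀
  open Comparison ℓ
  more-central : (T : Tree) → Pointwise _↭_ (degLevels T) (degLevels T₀) → countEccLe ℓ T ≤ countEccLe ℓ G
  more-central T sameDeg = begin
    countEccLe ℓ T                                     ≡⟨ countEccLe≡below ℓ T ⟩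
    below (λ z → ecc T z ≤? ℓ) (suc ℓ) (positions T)   ≤⟨ below-mono _ _ (suc ℓ) (positions T) (positions G)
                                                            (λ k _ → compare k T G (greedy-dominates-same T same) deep) ⟩
    below (λ z → ecc G z ≤? ℓ) (suc ℓ) (positions G)   ≡⟨ countEccLe≡below ℓ G ⟨
    countEccLe ℓ G                                     ∎
    where
    open ≤-Reasoning
    same : ∀ r → levels T r ↭ levels T₀ r
    same = sameDegLevels⇒sameLevels T T₀ sameDeg
    -- T and G have the same widths, so in particular on deep levels
    deep : ∀ {k} → DeepWider k T G
    deep r _ = ≤-reflexive (sameLevels⇒sameWidth G T (λ j → ↭-trans (greedy-sameLevels j) (↭-sym (same j))) r)
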